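{- Let $\Gamma=(V,E)$ be a finite connected graph of valency $d\ge3$, and let $G\le\mathrm{Aut}\,\Gamma$ act primitively on $E$. Let $\{u,v\}\in E$ and $1\ne N\trianglelefteq G$. If $N$ is transitive on $V$ then $2|N_v|=d\,|N_{\{u,v\}}|$; if $N$ is intransitive on $V$ then $|N_v|=d\,|N_{\{u,v\}}|=d\,|N_{uv}|$. In particular, $N_v\ne1$ and $N_v\ne N_{\{u,v\}}$.
   Context: $N_v$ is the stabilizer of the vertex $v$ in $N$, $N_{uv}=N_u\cap N_v$, and $N_{\{u,v\}}$ is the setwise stabilizer of the edge $\{u,v\}$ in $N$. -}

module Defs where

open import Data.Nat using (ℕ; suc; _*_)
open import Data.Bool using (Bool; true)
open import Data.Fin using (Fin)
open import Data.Fin.Properties using (_≟_)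
open import Data.Vec using (Vec; lookup; tabulate; allFin)
open import Data.List using (List; filter; length)
import Data.Vec as V
open import Data.List.Membership.Propositional using (_∈_)
open import Data.List.Relation.Unary.Unique.Propositional using (Unique)
open import Data.Product using (Σ; _×_; _,_; ∃)
open import Data.Sum using (_⊎_)
open import Relation.Binary.PropositionalEquality using (_≡_; _≢_)
open import Relation.Nullary using (¬_; Dec)
open import Relation.Nullary.Decidable using (_×-dec_; _⊎-dec_)
open import Function using (Injective)
open import Level using (0ℓ) renaming (suc to lsuc)

record Graph (n : ℕ) : Set where
  field
    adj      : Fin n → Fin n → Bool
    adj-sym  : ∀ a b → adj a b ≡ adj b a
    adj-irr  : ∀ a → ¬ (adj a a ≡ true)

open Graph public

Adj : ∀ {n} → Graph n → Fin n → Fin n → Set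
Adj Γ a b = adj Γ a b ≡ true

data Reach {n} (Γ : Graph n) : Fin n → Fin n → Set where
  here : ∀ {a} → Reach Γ a a
  step : ∀ {a b c} → Adj Γ a b → Reach Γ b c → Reach Γ a c

Connected : ∀ {n} → Graph n → Set
Connected Γ = ∀ a b → Reach Γ a b

valency : ∀ {n} → Graph n → Fin n → ℕ
valency {n} Γ v = length (filter (λ w → adj Γ v w B.≟ true) (L.allFin n))
  where import Data.Bool as B
        import Data.List as L

Regular : ∀ {n} → Graph n → ℕ → Set
Regular Γ d = ∀ v → valency Γ v ≡ d

Perm : ℕ → Set
Perm n = Vec (Fin n) n

app : ∀ {n} → Perm n → Fin n → Fin n
app = lookup

idP : ∀ {n} → Perm n
idP = tabulate (λ i → i)

_∘P_ : ∀ {n} → Perm n → Perm n → Perm n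
σ ∘P τ = tabulate (λ i → app σ (app τ i))

-- a finite group of permutations, given as a duplicate-free list of its elements
record PermGroup (n : ℕ) (G : List (Perm n)) : Set where
  field
    unique  : Unique G
    bij     : ∀ {g} → g ∈ G → Injective _≡_ _≡_ (app g)
    has-id  : idP ∈ G
    closed  : ∀ {g h} → g ∈ G → h ∈ G → (g ∘P h) ∈ G
    has-inv : ∀ {g} → g ∈ G → Σ (Perm n) λ h → h ∈ G × (h ∘P g ≡ idP)

AutGroup : ∀ {n} → Graph n → List (Perm n) → Set
AutGroup Γ G = PermGroup _ G × (∀ {g} → g ∈ G → ∀ a b → adj Γ (app g a) (app g b) ≡ adj Γ a b)

_⊆G_ : ∀ {n} → List (Perm n) → List (Perm n) → Set
N ⊆G G = ∀ {x} → x ∈ N → x ∈ G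

-- N ⊴ G  (N a subgroup of G closed under conjugation by G: g N g⁻¹ ⊆ N)
Normal : ∀ {n} → List (Perm n) → List (Perm n) → Set
Normal {n} N G = PermGroup n N × N ⊆G G ×
  (∀ {g x} → g ∈ G → x ∈ N → Σ (Perm n) λ y → y ∈ N × (g ∘P x ≡ y ∘P g))

Nontrivial : ∀ {n} → List (Perm n) → Set
Nontrivial N = Σ _ λ x → x ∈ N × x ≢ idP

MapsPair : ∀ {n} → Perm n → Fin n → Fin n → Fin n → Fin n → Set
MapsPair g a b c d = (app g a ≡ c × app g b ≡ d) ⊎ (app g a ≡ d × app g b ≡ c)

SamePair : ∀ {n} → Fin n → Fin n → Fin n → Fin n → Set
SamePair a b c d = (a ≡ c × b ≡ d) ⊎ (a ≡ d × b ≡ c)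

EdgeTransitive : ∀ {n} → Graph n → List (Perm n) → Set
EdgeTransitive Γ G = ∀ a b c d → Adj Γ a b → Adj Γ c d →
  Σ _ λ g → g ∈ G × MapsPair g a b c d

record EdgeSet {n} (Γ : Graph n) : Set₁ where
  field
    mem     : Fin n → Fin n → Set
    mem-sym : ∀ a b → mem a b → mem b a
    mem-adj : ∀ a b → mem a b → Adj Γ a b
open EdgeSet public

-- B is a block for G acting on E: every g ∈ G has gB = B or gB ∩ B = ∅
-- (since g permutes the finite set E, gB ⊆ B is equivalent to gB = B)
IsBlock : ∀ {n} {Γ : Graph n} → List (Perm n) → EdgeSet Γ → Set
IsBlock G B = ∀ {g} → g ∈ G →
  (∀ a b → mem B a b → mem B (app g a) (app g b)) ⊎
  (∀ a b → mem B a b → ¬ mem B (app g a) (app g b))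

TrivialBlock : ∀ {n} {Γ : Graph n} → EdgeSet Γ → Set
TrivialBlock {Γ = Γ} B =
  (∀ a b c d → mem B a b → mem B c d → SamePair a b c d) ⊎
  (∀ a b → Adj Γ a b → mem B a b)

EdgePrimitive : ∀ {n} → Graph n → List (Perm n) → Set₁
EdgePrimitive Γ G = EdgeTransitive Γ G × (∀ (B : EdgeSet Γ) → IsBlock G B → TrivialBlock B)

VertexTransitive : ∀ {n} → List (Perm n) → Set
VertexTransitive N = ∀ a b → Σ _ λ x → x ∈ N × app x a ≡ b

stab : ∀ {n} → List (Perm n) → Fin n → List (Perm n)
stab N v = filter (λ x → app x v ≟ v) N

stab2 : ∀ {n} → List (Perm n) → Fin n → Fin n → List (Perm n)
stab2 N u v = filter (λ x → (app x u ≟ u) ×-dec (app x v ≟ v)) N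

stabE : ∀ {n} → List (Perm n) → Fin n → Fin n → List (Perm n)
stabE N u v = filter (λ x → ((app x u ≟ u) ×-dec (app x v ≟ v)) ⊎-dec ((app x u ≟ v) ×-dec (app x v ≟ u))) N

module Submission where

-- Proof.  (1) N is edge-transitive: the N-orbit of {u,v} is a block of G on the
-- edges (by normality); it is not a single edge, for then N would fix every edge
-- and hence, every vertex having two neighbours, every vertex.  So it is all of E.
-- (2) If some x ∈ N maps u to v, then the N-orbit of v is closed under adjacency,
-- so N is vertex-transitive as Γ is connected.
-- (3) Count X = {x ∈ N | v ∈ x{u,v}} twice.  By edge-transitivity X is in
-- bijection with (neighbours of v) × N_{u,v}, so |X| = d|N_{u,v}|.  As u ≠ v,
-- X = Shift ⊔ N_v with Shift = {x ∈ N | x u = v}.  Shift is a coset of N_v when N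
-- is vertex-transitive and is empty otherwise (by (2)); this gives both equations,
-- and in either case d|N_{u,v}| ≤ 2|N_v|, whence |N_v| ≥ 2 and |N_v| ≠ |N_{u,v}|.

open import Defs
open import Data.Nat using (ℕ; _≥_; _*_)
open import Data.Fin using (Fin)
open import Data.List using (List; length)
open import Data.List.Membership.Propositional using (_∈_)
open import Data.Product using (_×_)
open import Relation.Binary.PropositionalEquality using (_≡_)
open import Relation.Nullary using (¬_)

open import Data.Nat using (zero; suc; _+_; _≤_; z≤n; s≤s)
import Data.Nat.Properties as ℕ
open import Data.Fin.Properties using (_≟_)
open import Data.Bool using (true)
import Data.Bool as Bool
open import Data.Vec using (tabulate)
import Data.Vec.Properties as Vec
open import Data.List using ([]; _∷_; _++_; filter; allFin; cartesianProduct; map)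
open import Data.List.Properties using (length-++; length-map; filter-none)
open import Data.List.Membership.Propositional using (find; lose)
open import Data.List.Membership.Propositional.Properties
  using (∈-filter⁺; ∈-filter⁻; ∈-allFin; ∈-cartesianProduct⁺; ∈-cartesianProduct⁻; ∈-length)
open import Data.List.Relation.Unary.Any using (here; there; any?)
open import Data.List.Relation.Unary.All using (_∷_)
import Data.List.Relation.Unary.All as All
open import Data.List.Relation.Unary.AllPairs using (_∷_)
open import Data.List.Relation.Unary.Unique.Propositional using (Unique)
import Data.List.Relation.Unary.Unique.Propositional.Properties as Unique
open import Data.Product using (Σ; _,_; proj₁; proj₂)
open import Data.Sum using (_⊎_; inj₁; inj₂)
open import Data.Empty using (⊥; ⊥-elim)
open import Relation.Nullary using (Dec; yes; no)
open import Relation.Nullary.Decidable using (_×-dec_; _⊎-dec_; map′)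
open import Relation.Binary.PropositionalEquality
  using (refl; sym; trans; cong; cong₂; subst; subst₂; _≢_; module ≡-Reasoning)

-- Counting members of lists

module _ {A : Set} where

  search : ∀ {Q : A → Set} → (∀ x → Dec (Q x)) → (xs : List A) → Dec (Σ A λ x → x ∈ xs × Q x)
  search Q? xs = map′ find (λ { (_ , x∈ , q) → lose x∈ q }) (any? Q? xs)

  delete : ∀ {y : A} {ys : List A} → y ∈ ys →
    Σ (List A) λ ys′ → length ys ≡ suc (length ys′) × (∀ {z} → z ∈ ys → z ≢ y → z ∈ ys′)
  delete {ys = _ ∷ ys} (here refl) =
    ys , refl , λ { (here refl) z≢y → ⊥-elim (z≢y refl) ; (there z∈) _ → z∈ }
  delete {ys = y′ ∷ _} (there y∈) with delete y∈
  ... | ys′ , len , keep =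
    y′ ∷ ys′ , cong suc len , λ { (here refl) _ → here refl ; (there z∈) z≢y → there (keep z∈ z≢y) }

  two-distinct : (xs : List A) → Unique xs → 2 ≤ length xs →
    Σ A λ p → Σ A λ q → p ∈ xs × q ∈ xs × p ≢ q
  two-distinct (p ∷ q ∷ _) ((p≢q ∷ _) ∷ _) _ = p , q , here refl , there (here refl) , p≢q
  two-distinct (_ ∷ []) _ (s≤s ())

record ListInjection {X Y : Set} (xs : List X) (ys : List Y) : Set where
  field
    fun       : X → Y
    into      : ∀ {x} → x ∈ xs → fun x ∈ ys
    injective : ∀ {x x′} → x ∈ xs → x′ ∈ xs → fun x ≡ fun x′ → x ≡ x′

injection-≤ : ∀ {X Y : Set} {xs : List X} {ys : List Y} →
  Unique xs → ListInjection xs ys → length xs ≤ length ys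
injection-≤ {xs = []} _ _ = z≤n
injection-≤ {xs = x ∷ xs} (x∉xs ∷ uniq) f with delete (ListInjection.into f (here refl))
... | ys′ , len , keep = subst (suc (length xs) ≤_) (sym len) (s≤s (injection-≤ uniq restriction))
  where
    open ListInjection f
    -- f restricted to xs avoids f x, since x ∉ xs
    restriction : ListInjection xs ys′
    restriction = record
      { fun       = fun
      ; into      = λ x′∈ → keep (into (there x′∈))
                      (λ fx′≡fx → All.lookup x∉xs x′∈ (injective (here refl) (there x′∈) (sym fx′≡fx)))
      ; injective = λ x∈ x′∈ → injective (there x∈) (there x′∈)
      }

bijection-length : ∀ {X Y : Set} {xs : List X} {ys : List Y} → Unique xs → Unique ys →
  ListInjection xs ys → ListInjection ys xs → length xs ≡ length ys
bijection-length uxs uys f g = ℕ.≤-antisym (injection-≤ uxs f) (injection-≤ uys g)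

length-cartesianProduct : ∀ {A B : Set} (xs : List A) (ys : List B) →
  length (cartesianProduct xs ys) ≡ length xs * length ys
length-cartesianProduct [] ys = refl
length-cartesianProduct (x ∷ xs) ys = begin
  length (map (x ,_) ys ++ cartesianProduct xs ys)      ≡⟨ length-++ (map (x ,_) ys) ⟩
  length (map (x ,_) ys) + length (cartesianProduct xs ys)
    ≡⟨ cong₂ _+_ (length-map (x ,_) ys) (length-cartesianProduct xs ys) ⟩
  length ys + length xs * length ys                       ∎
  where open ≡-Reasoning

module _ {A : Set} {P Q : A → Set} (P? : ∀ x → Dec (P x)) (Q? : ∀ x → Dec (Q x)) where

  length-filter-⊎ : ∀ xs → (∀ {x} → x ∈ xs → P x → Q x → ⊥) →
    length (filter (λ x → P? x ⊎-dec Q? x) xs) ≡ length (filter P? xs) + length (filter Q? xs)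
  length-filter-⊎ [] _ = refl
  length-filter-⊎ (x ∷ xs) disjoint with P? x | Q? x
  ... | yes p | yes q = ⊥-elim (disjoint (here refl) p q)
  ... | yes _ | no _  = cong suc (length-filter-⊎ xs (λ x∈ → disjoint (there x∈)))
  ... | no _  | yes _ = trans (cong suc (length-filter-⊎ xs (λ x∈ → disjoint (there x∈)))) (sym (ℕ.+-suc _ _))
  ... | no _  | no _  = length-filter-⊎ xs (λ x∈ → disjoint (there x∈))

  length-filter-cong : ∀ xs → (∀ {x} → x ∈ xs → P x → Q x) → (∀ {x} → x ∈ xs → Q x → P x) →
    length (filter P? xs) ≡ length (filter Q? xs)
  length-filter-cong [] _ _ = refl
  length-filter-cong (x ∷ xs) P⇒Q Q⇒P with P? x | Q? x
  ... | yes _ | yes _ = cong suc (length-filter-cong xs (λ x∈ → P⇒Q (there x∈)) (λ x∈ → Q⇒P (there x∈)))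
  ... | yes p | no ¬q = ⊥-elim (¬q (P⇒Q (here refl) p))
  ... | no ¬p | yes q = ⊥-elim (¬p (Q⇒P (here refl) q))
  ... | no _  | no _  = length-filter-cong xs (λ x∈ → P⇒Q (there x∈)) (λ x∈ → Q⇒P (there x∈))

-- Permutations as value tables

module _ {n : ℕ} where

  app-∘ : ∀ (σ τ : Perm n) i → app (σ ∘P τ) i ≡ app σ (app τ i)
  app-∘ σ τ = Vec.lookup∘tabulate (λ j → app σ (app τ j))

  app-id : ∀ i → app (idP {n}) i ≡ i
  app-id = Vec.lookup∘tabulate (λ j → j)

  perm-ext : ∀ {σ τ : Perm n} → (∀ i → app σ i ≡ app τ i) → σ ≡ τ
  perm-ext {σ} {τ} σ≗τ = begin
    σ                ≡⟨ sym (Vec.tabulate∘lookup σ) ⟩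
    tabulate (app σ) ≡⟨ Vec.tabulate-cong σ≗τ ⟩
    tabulate (app τ) ≡⟨ Vec.tabulate∘lookup τ ⟩
    τ                ∎
    where open ≡-Reasoning

  non-identity : (xs : List (Perm n)) → Unique xs → 2 ≤ length xs → Nontrivial xs
  non-identity xs uniq 2≤ with two-distinct xs uniq 2≤
  ... | p , q , p∈ , q∈ , p≢q with Vec.≡-dec _≟_ p idP
  ...   | no p≢id    = p , p∈ , p≢id
  ...   | yes refl   = q , q∈ , λ q≡id → p≢q (sym q≡id)

-- Unordered pairs.
-- MapsPair σ a b c d, i.e. σ{a,b} = {c,d}, unfolds to SamePair (σ a) (σ b) c d.

module _ {n : ℕ} where

  sp-refl : ∀ {a b : Fin n} → SamePair a b a b
  sp-refl = inj₁ (refl , refl)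

  sp-flip : ∀ {a b c d : Fin n} → SamePair a b c d → SamePair a b d c
  sp-flip (inj₁ eqs) = inj₂ eqs
  sp-flip (inj₂ eqs) = inj₁ eqs

  sp-sym : ∀ {a b c d : Fin n} → SamePair a b c d → SamePair c d a b
  sp-sym (inj₁ (refl , refl)) = inj₁ (refl , refl)
  sp-sym (inj₂ (refl , refl)) = inj₂ (refl , refl)

  sp-trans : ∀ {a b c d a′ b′ : Fin n} → SamePair a b c d → SamePair c d a′ b′ → SamePair a b a′ b′
  sp-trans (inj₁ (refl , refl)) q = q
  sp-trans (inj₂ (refl , refl)) (inj₁ (refl , refl)) = inj₂ (refl , refl)
  sp-trans (inj₂ (refl , refl)) (inj₂ (refl , refl)) = inj₁ (refl , refl)

  sp-map : ∀ {a b c d} (f : Fin n → Fin n) → SamePair a b c d → SamePair (f a) (f b) (f c) (f d)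
  sp-map f (inj₁ (refl , refl)) = inj₁ (refl , refl)
  sp-map f (inj₂ (refl , refl)) = inj₂ (refl , refl)

  sp-unmap : ∀ {a b c d} {f : Fin n → Fin n} → (∀ {i j} → f i ≡ f j → i ≡ j) →
    SamePair (f a) (f b) (f c) (f d) → SamePair a b c d
  sp-unmap inj (inj₁ (e₁ , e₂)) = inj₁ (inj e₁ , inj e₂)
  sp-unmap inj (inj₂ (e₁ , e₂)) = inj₂ (inj e₁ , inj e₂)

module _ {n : ℕ} where

  maps-∘ : ∀ (σ τ : Perm n) {a b c d a′ b′} → MapsPair τ a b c d → MapsPair σ c d a′ b′ → MapsPair (σ ∘P τ) a b a′ b′
  maps-∘ σ τ {a} {b} {a′ = a′} {b′} τab σcd = subst₂ (λ p q → SamePair p q a′ b′) (sym (app-∘ σ τ a)) (sym (app-∘ σ τ b))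
                     (sp-trans (sp-map (app σ) τab) σcd)

  maps-∘⁻ : ∀ (σ τ : Perm n) {a b c d} → MapsPair (σ ∘P τ) a b c d → MapsPair σ (app τ a) (app τ b) c d
  maps-∘⁻ σ τ {a} {b} {c} {d} = subst₂ (λ p q → SamePair p q c d) (app-∘ σ τ a) (app-∘ σ τ b)

  maps-inverse : ∀ (σ τ : Perm n) {a b c d} → (∀ i → app τ (app σ i) ≡ i) → MapsPair σ a b c d → MapsPair τ c d a b
  maps-inverse σ τ {a} {b} {c} {d} τσ σab = sp-sym (subst₂ (λ p q → SamePair p q (app τ c) (app τ d)) (τσ a) (τσ b)
                                  (sp-map (app τ) σab))

  maps-unique-source : ∀ (σ : Perm n) {a b c d a′ b′} → (∀ {i j} → app σ i ≡ app σ j → i ≡ j) →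
    MapsPair σ a b a′ b′ → MapsPair σ c d a′ b′ → SamePair a b c d
  maps-unique-source σ inj σab σcd = sp-unmap inj (sp-trans σab (sp-sym σcd))

maps-id : ∀ {n} {a b : Fin n} → MapsPair idP a b a b
maps-id {a = a} {b} = inj₁ (app-id a , app-id b)

maps? : ∀ {n} (σ : Perm n) a b c d → Dec (MapsPair σ a b c d)
maps? σ a b c d = ((app σ a ≟ c) ×-dec (app σ b ≟ d)) ⊎-dec ((app σ a ≟ d) ×-dec (app σ b ≟ c))

-- Finite permutation groups

module PermGroupFacts {n : ℕ} {H : List (Perm n)} (HG : PermGroup n H) where
  open PermGroup HG

  inverse : ∀ {g} → g ∈ H → Σ (Perm n) λ h → h ∈ H ×
    (∀ i → app h (app g i) ≡ i) × (∀ i → app g (app h i) ≡ i)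
  inverse {g} g∈ with has-inv g∈
  ... | h , h∈ , h∘g≡id with has-inv h∈
  ...   | h′ , _ , h′∘h≡id = h , h∈ , left h g h∘g≡id , right
    where
      left : ∀ (σ τ : Perm n) → σ ∘P τ ≡ idP → ∀ i → app σ (app τ i) ≡ i
      left σ τ σ∘τ≡id i = trans (sym (app-∘ σ τ i)) (trans (cong (λ ρ → app ρ i) σ∘τ≡id) (app-id i))
      -- h′ = h′ ∘ h ∘ g = g
      h′≗g : ∀ j → app h′ j ≡ app g j
      h′≗g j = trans (cong (app h′) (sym (left h g h∘g≡id j))) (left h′ h h′∘h≡id (app g j))
      right : ∀ i → app g (app h i) ≡ i
      right i = trans (sym (h′≗g (app h i))) (left h′ h h′∘h≡id i)

  cancelˡ : ∀ {k x x′} → k ∈ H → k ∘P x ≡ k ∘P x′ → x ≡ x′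
  cancelˡ {k} {x} {x′} k∈ kx≡kx′ = perm-ext λ j →
    bij k∈ (trans (sym (app-∘ k x j)) (trans (cong (λ ρ → app ρ j) kx≡kx′) (app-∘ k x′ j)))

  cancelʳ : ∀ {k x x′} → k ∈ H → x ∘P k ≡ x′ ∘P k → x ≡ x′
  cancelʳ {k} {x} {x′} k∈ xk≡x′k with inverse k∈
  ... | h , _ , _ , k∘h≗id = perm-ext λ j → begin
    app x j                 ≡⟨ cong (app x) (sym (k∘h≗id j)) ⟩
    app x (app k (app h j)) ≡⟨ sym (app-∘ x k (app h j)) ⟩
    app (x ∘P k) (app h j)  ≡⟨ cong (λ ρ → app ρ (app h j)) xk≡x′k ⟩
    app (x′ ∘P k) (app h j) ≡⟨ app-∘ x′ k (app h j) ⟩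
    app x′ (app k (app h j)) ≡⟨ cong (app x′) (k∘h≗id j) ⟩
    app x′ j                ∎
    where open ≡-Reasoning

  module _ {Q : Perm n → Set} (Q? : ∀ x → Dec (Q x)) where
    private
      pick : Dec (Σ (Perm n) λ x → x ∈ H × Q x) → Perm n
      pick (yes (x , _)) = x
      pick (no _)        = idP

      pick-∈ : (D : Dec (Σ (Perm n) λ x → x ∈ H × Q x)) → pick D ∈ H
      pick-∈ (yes (_ , x∈ , _)) = x∈
      pick-∈ (no _)             = has-id

      pick-spec : (D : Dec (Σ (Perm n) λ x → x ∈ H × Q x)) → Σ (Perm n) (λ x → x ∈ H × Q x) → Q (pick D)
      pick-spec (yes (_ , _ , q)) _ = q
      pick-spec (no none) some      = ⊥-elim (none some)

    choose : Perm n
    choose = pick (search Q? H)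

    choose-∈ : choose ∈ H
    choose-∈ = pick-∈ (search Q? H)

    choose-spec : Σ (Perm n) (λ x → x ∈ H × Q x) → Q choose
    choose-spec = pick-spec (search Q? H)

  -- If t ∈ H sends a to b, then x ↦ x t and x ↦ x t⁻¹ are mutually inverse
  -- bijections between {x ∈ H | x b = c} and {x ∈ H | x a = c}: these cosets of
  -- point stabilisers have equal size.
  coset-size : ∀ {t a b c} → t ∈ H → app t a ≡ b →
    length (filter (λ x → app x a ≟ c) H) ≡ length (filter (λ x → app x b ≟ c) H)
  coset-size {t} {a} {b} {c} t∈ ta≡b with inverse t∈
  ... | h , h∈ , h∘t≗id , _ =
    bijection-length (Unique.filter⁺ (λ x → app x a ≟ c) unique) (Unique.filter⁺ (λ x → app x b ≟ c) unique)
      (translate h h∈ hb≡a) (translate t t∈ ta≡b)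
    where
      hb≡a : app h b ≡ a
      hb≡a = trans (cong (app h) (sym ta≡b)) (h∘t≗id a)
      translate : ∀ {p q} (s : Perm n) → s ∈ H → app s q ≡ p →
        ListInjection (filter (λ x → app x p ≟ c) H) (filter (λ x → app x q ≟ c) H)
      translate {p} {q} s s∈ sq≡p = record
        { fun       = _∘P s
        ; into      = λ {x} x∈ → let x∈H , xp≡c = ∈-filter⁻ (λ x → app x p ≟ c) {xs = H} x∈ in
                        ∈-filter⁺ (λ x → app x q ≟ c) (closed x∈H s∈)
                          (trans (app-∘ x s q) (trans (cong (app x) sq≡p) xp≡c))
        ; injective = λ _ _ → cancelʳ s∈
        }

-- Graphs

module GraphFacts {n : ℕ} (Γ : Graph n) where

  adjacent? : ∀ w z → Dec (Adj Γ w z)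
  adjacent? w z = adj Γ w z Bool.≟ true

  neighbours : Fin n → List (Fin n)
  neighbours w = filter (adjacent? w) (allFin n)

  neighbours-unique : ∀ w → Unique (neighbours w)
  neighbours-unique w = Unique.filter⁺ (adjacent? w) (Unique.allFin⁺ n)

  ∈-neighbours⁺ : ∀ {w z} → Adj Γ w z → z ∈ neighbours w
  ∈-neighbours⁺ {w} {z} wz = ∈-filter⁺ (adjacent? w) (∈-allFin z) wz

  ∈-neighbours⁻ : ∀ {w z} → z ∈ neighbours w → Adj Γ w z
  ∈-neighbours⁻ {w} z∈ = proj₂ (∈-filter⁻ (adjacent? w) {xs = allFin n} z∈)

  adjacent-distinct : ∀ {a b} → Adj Γ a b → a ≢ b
  adjacent-distinct {a} ab refl = adj-irr Γ a ab

  same-far-end : ∀ {a b c} → Adj Γ a b → SamePair a b a c → b ≡ c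
  same-far-end _  (inj₁ (_ , b≡c))    = b≡c
  same-far-end ab (inj₂ (_ , b≡a))    = ⊥-elim (adjacent-distinct ab (sym b≡a))

  -- A permutation fixing every edge setwise is the identity when every vertex w
  -- has two neighbours p ≠ q: x{w,p} = {w,p} and x{w,q} = {w,q} force x w = w.
  edge-fixer-trivial : (∀ w → 2 ≤ valency Γ w) →
    (x : Perm n) → (∀ a b → Adj Γ a b → MapsPair x a b a b) → x ≡ idP
  edge-fixer-trivial branching x fixes = perm-ext λ w → trans (fixed w) (sym (app-id w))
    where
      fixed : ∀ w → app x w ≡ w
      fixed w with app x w ≟ w
      ... | yes xw≡w = xw≡w
      ... | no xw≢w with two-distinct (neighbours w) (neighbours-unique w) (branching w)
      ...   | p , q , p∈ , q∈ , p≢q with fixes w p (∈-neighbours⁻ p∈) | fixes w q (∈-neighbours⁻ q∈)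
      ...     | inj₁ (xw≡w , _) | _                = ⊥-elim (xw≢w xw≡w)
      ...     | _                | inj₁ (xw≡w , _) = ⊥-elim (xw≢w xw≡w)
      ...     | inj₂ (xw≡p , _) | inj₂ (xw≡q , _) = ⊥-elim (p≢q (trans (sym xw≡p) xw≡q))

  maps-edge : ∀ {G} → AutGroup Γ G → ∀ {g a b c d} → g ∈ G → MapsPair g a b c d → Adj Γ a b → Adj Γ c d
  maps-edge aut g∈ (inj₁ (refl , refl)) ab = trans (proj₂ aut g∈ _ _) ab
  maps-edge aut g∈ (inj₂ (refl , refl)) ab = trans (adj-sym Γ _ _) (trans (proj₂ aut g∈ _ _) ab)

module NormalEdgeTransitivity {n : ℕ} (Γ : Graph n) {G N : List (Perm n)}
  (aut : AutGroup Γ G) (prim : EdgePrimitive Γ G) (nor : Normal N G) (ntr : Nontrivial N)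
  (branching : ∀ w → 2 ≤ valency Γ w) {u v : Fin n} (uv : Adj Γ u v) where

  private
    N⊆G : N ⊆G G
    N⊆G = proj₁ (proj₂ nor)
    conjugate : ∀ {g x} → g ∈ G → x ∈ N → Σ (Perm n) λ y → y ∈ N × (g ∘P x ≡ y ∘P g)
    conjugate = proj₂ (proj₂ nor)
    module G = PermGroupFacts (proj₁ aut)
    open PermGroup (proj₁ nor) using (closed; has-id)
    open PermGroupFacts (proj₁ nor) using (inverse)

  InOrbit : Fin n → Fin n → Set
  InOrbit a b = Σ (Perm n) λ x → x ∈ N × MapsPair x u v a b

  orbit : EdgeSet Γ
  orbit = record
    { mem     = InOrbit
    ; mem-sym = λ { _ _ (x , x∈ , m) → x , x∈ , sp-flip m }
    ; mem-adj = λ { _ _ (x , x∈ , m) → GraphFacts.maps-edge Γ aut (N⊆G x∈) m uv }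
    }

  conjugate-orbit : ∀ {g a b} → g ∈ G → InOrbit a b →
    Σ (Perm n) λ y → y ∈ N × MapsPair y (app g u) (app g v) (app g a) (app g b)
  conjugate-orbit {g} {a} {b} g∈ (x , x∈ , m) with conjugate g∈ x∈
  ... | y , y∈ , gx≡yg =
    y , y∈ , maps-∘⁻ y g (subst (λ σ → MapsPair σ u v (app g a) (app g b)) gx≡yg (maps-∘ g x m sp-refl))

  -- Hence g maps the orbit onto itself if g{u,v} is in it, and off itself otherwise.
  orbit-is-block : IsBlock G orbit
  orbit-is-block {g} g∈ with search (λ x → maps? x u v (app g u) (app g v)) N
  ... | yes (w , w∈ , mw) = inj₁ λ a b o →
    let y , y∈ , my = conjugate-orbit g∈ o in y ∘P w , closed y∈ w∈ , maps-∘ y w mw my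
  ... | no g[uv]∉orbit = inj₂ λ a b o → λ { (w , w∈ , mw) →
    let y , y∈ , my = conjugate-orbit g∈ o
        h , h∈ , h∘y≗id , _ = inverse y∈
    in g[uv]∉orbit (h ∘P w , closed h∈ w∈ , maps-∘ h w mw (maps-inverse y h h∘y≗id my)) }

  -- If the orbit were the single edge {u,v}, N would fix every edge, so N = 1.
  orbit-not-single : ¬ (∀ a b c d → InOrbit a b → InOrbit c d → SamePair a b c d)
  orbit-not-single single =
    proj₂ (proj₂ ntr) (GraphFacts.edge-fixer-trivial Γ branching _ (fixes-every-edge (proj₁ (proj₂ ntr))))
    where
      fixes-uv : ∀ {y} → y ∈ N → MapsPair y u v u v
      fixes-uv {y} y∈ = single (app y u) (app y v) u v (y , y∈ , sp-refl) (idP , has-id , maps-id)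
      -- with g{u,v} = {a,b} and h = g⁻¹: h y = y′ h for some y′ ∈ N fixing {u,v},
      -- so h maps both y{a,b} and {a,b} onto {u,v}
      fixes-every-edge : ∀ {y} → y ∈ N → ∀ a b → Adj Γ a b → MapsPair y a b a b
      fixes-every-edge {y} y∈ a b ab with proj₁ prim u v a b uv ab
      ... | g , g∈ , g[uv]≡ab with G.inverse g∈
      ...   | h , h∈ , h∘g≗id , _ with conjugate h∈ y∈
      ...     | y′ , y′∈ , hy≡y′h =
        let h[ab]≡uv = maps-inverse g h h∘g≗id g[uv]≡ab
            hy[ab]≡uv = subst (λ σ → MapsPair σ a b u v) (sym hy≡y′h) (maps-∘ y′ h h[ab]≡uv (fixes-uv y′∈))
        in maps-unique-source h (PermGroup.bij (proj₁ aut) h∈) (maps-∘⁻ h y hy[ab]≡uv) h[ab]≡uv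

  edge-transitive : ∀ a b → Adj Γ a b → InOrbit a b
  edge-transitive a b ab with proj₂ prim orbit orbit-is-block
  ... | inj₁ single     = ⊥-elim (orbit-not-single single)
  ... | inj₂ everything = everything a b ab

-- If some t ∈ N maps u to v, then N is
-- vertex-transitive: each edge {a,b} is x{u,v}, so b = x v or b = x u = (x t⁻¹) v,
-- hence the N-orbit of v is closed under adjacency and contains every vertex.

module VertexTransitivity {n : ℕ} (Γ : Graph n) {N : List (Perm n)} (NG : PermGroup n N)
  (conn : Connected Γ) {u v : Fin n}
  (edge-transitive : ∀ a b → Adj Γ a b → Σ (Perm n) λ x → x ∈ N × MapsPair x u v a b)
  {t : Perm n} (t∈ : t ∈ N) (tu≡v : app t u ≡ v) where

  open PermGroup NG using (closed; has-id)
  open PermGroupFacts NG using (inverse)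

  InOrbitOfV : Fin n → Set
  InOrbitOfV c = Σ (Perm n) λ x → x ∈ N × app x v ≡ c

  endpoint-in-orbit : ∀ a b → Adj Γ a b → InOrbitOfV b
  endpoint-in-orbit a b ab with edge-transitive a b ab | inverse t∈
  ... | x , x∈ , inj₁ (_ , xv≡b) | _ = x , x∈ , xv≡b
  ... | x , x∈ , inj₂ (xu≡b , _) | h , h∈ , h∘t≗id , _ = x ∘P h , closed x∈ h∈ , (begin
    app (x ∘P h) v   ≡⟨ app-∘ x h v ⟩
    app x (app h v)  ≡⟨ cong (λ w → app x (app h w)) (sym tu≡v) ⟩
    app x (app h (app t u)) ≡⟨ cong (app x) (h∘t≗id u) ⟩
    app x u          ≡⟨ xu≡b ⟩
    b                ∎)
    where open ≡-Reasoning

  every-vertex-in-orbit : ∀ c → InOrbitOfV c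
  every-vertex-in-orbit c = along (conn v c) (idP , has-id , app-id v)
    where
      along : ∀ {a c} → Reach Γ a c → InOrbitOfV a → InOrbitOfV c
      along here        a∈ = a∈
      along (step ab r) _  = along r (endpoint-in-orbit _ _ ab)

  vertex-transitive : VertexTransitive N
  vertex-transitive a b with every-vertex-in-orbit a | every-vertex-in-orbit b
  ... | x , x∈ , xv≡a | y , y∈ , yv≡b with inverse x∈
  ...   | h , h∈ , h∘x≗id , _ = y ∘P h , closed y∈ h∈ , (begin
    app (y ∘P h) a  ≡⟨ app-∘ y h a ⟩
    app y (app h a) ≡⟨ cong (λ w → app y (app h w)) (sym xv≡a) ⟩
    app y (app h (app x v)) ≡⟨ cong (app y) (h∘x≗id v) ⟩
    app y v         ≡⟨ yv≡b ⟩
    b               ∎)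
    where open ≡-Reasoning

-- The set AtV = {x ∈ N | v ∈ x{u,v}} is in bijection with
-- (neighbours of v) × N_{u,v}: x ↦ (w, k_w x), where x{u,v} = {v,w} and
-- k_w ∈ N maps {v,w} to {u,v}, with inverse (w, y) ↦ r_w y, r_w = k_w⁻¹.  On the other hand,
-- AtV is the disjoint union of {x | x u = v} and N_v.

module FlagCount {n : ℕ} (Γ : Graph n) {N : List (Perm n)} (autN : AutGroup Γ N)
  {u v : Fin n} (uv : Adj Γ u v)
  (edge-transitive : ∀ a b → Adj Γ a b → Σ (Perm n) λ x → x ∈ N × MapsPair x u v a b) where

  private
    NG = proj₁ autN
    open PermGroup NG using (unique; closed; bij)
    open PermGroupFacts NG using (inverse; cancelˡ; choose; choose-∈; choose-spec)
    open GraphFacts Γ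

  atV? : ∀ x → Dec ((app x u ≡ v) ⊎ (app x v ≡ v))
  atV? x = (app x u ≟ v) ⊎-dec (app x v ≟ v)

  AtV : List (Perm n)
  AtV = filter atV? N

  -- As u ≠ v, no x sends both u and v to v.
  AtV-split : length AtV ≡ length (filter (λ x → app x u ≟ v) N) + length (stab N v)
  AtV-split = length-filter-⊎ (λ x → app x u ≟ v) (λ x → app x v ≟ v) N
    (λ x∈ xu≡v xv≡v → adjacent-distinct uv (bij x∈ (trans xu≡v (sym xv≡v))))

  far-end : (x : Perm n) → Dec (app x u ≡ v) → Fin n
  far-end x (yes _) = app x v
  far-end x (no _)  = app x u

  far-end-spec : ∀ x (xu≟v : Dec (app x u ≡ v)) → (app x u ≡ v) ⊎ (app x v ≡ v) →
    MapsPair x u v v (far-end x xu≟v)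
  far-end-spec x (yes xu≡v) _             = inj₁ (xu≡v , refl)
  far-end-spec x (no xu≢v) (inj₁ xu≡v)    = ⊥-elim (xu≢v xu≡v)
  far-end-spec x (no _)    (inj₂ xv≡v)    = inj₂ (refl , xv≡v)

  other : Perm n → Fin n
  other x = far-end x (app x u ≟ v)

  ∈-AtV⁻ : ∀ {x} → x ∈ AtV → x ∈ N × MapsPair x u v v (other x) × Adj Γ v (other x)
  ∈-AtV⁻ {x} x∈ =
    let x∈N , at-v = ∈-filter⁻ atV? {xs = N} x∈
        x[uv]≡vw = far-end-spec x (app x u ≟ v) at-v
    in x∈N , x[uv]≡vw , maps-edge autN x∈N x[uv]≡vw uv

  r : Fin n → Perm n
  r w = choose (λ x → maps? x u v v w)

  r-maps : ∀ {w} → Adj Γ v w → MapsPair (r w) u v v w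
  r-maps {w} vw = choose-spec (λ x → maps? x u v v w) (edge-transitive v w vw)

  k : Fin n → Perm n
  k w = proj₁ (inverse (choose-∈ (λ x → maps? x u v v w)))

  k-∈ : ∀ w → k w ∈ N
  k-∈ w = proj₁ (proj₂ (inverse (choose-∈ (λ x → maps? x u v v w))))

  k-maps : ∀ {w} → Adj Γ v w → MapsPair (k w) v w u v
  k-maps {w} vw = maps-inverse (r w) (k w)
    (proj₁ (proj₂ (proj₂ (inverse (choose-∈ (λ x → maps? x u v v w)))))) (r-maps vw)

  Flags : List (Fin n × Perm n)
  Flags = cartesianProduct (neighbours v) (stabE N u v)

  ∈-Flags⁻ : ∀ {w y} → (w , y) ∈ Flags → Adj Γ v w × y ∈ N × MapsPair y u v u v
  ∈-Flags⁻ {w} {y} wy∈ with ∈-cartesianProduct⁻ (neighbours v) (stabE N u v) wy∈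
  ... | w∈ , y∈ = ∈-neighbours⁻ w∈ , ∈-filter⁻ (λ x → maps? x u v u v) {xs = N} y∈

  to-flag : ListInjection AtV Flags
  to-flag = record
    { fun       = λ x → other x , k (other x) ∘P x
    ; into      = λ {x} x∈ → let x∈N , x[uv]≡vw , vw = ∈-AtV⁻ x∈ in
        ∈-cartesianProduct⁺ (∈-neighbours⁺ vw)
          (∈-filter⁺ (λ x → maps? x u v u v) (closed (k-∈ _) x∈N) (maps-∘ (k _) x x[uv]≡vw (k-maps vw)))
    ; injective = λ {x} {x′} x∈ x′∈ same-flag →
        let same-end = cong proj₁ same-flag
        in cancelˡ (k-∈ (other x)) (trans (cong proj₂ same-flag) (cong (λ w → k w ∘P x′) (sym same-end)))
    }

  from-flag : ListInjection Flags AtV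
  from-flag = record
    { fun       = λ { (w , y) → r w ∘P y }
    ; into      = λ { {w , y} wy∈ → let vw , y∈ , y-fixes = ∈-Flags⁻ wy∈ in
        ∈-filter⁺ atV? (closed (choose-∈ _) y∈) (meets-v (r w ∘P y) (maps-∘ (r w) y y-fixes (r-maps vw))) }
    ; injective = λ { {w , y} {w′ , y′} wy∈ w′y′∈ same → let
          vw , _ , y-fixes = ∈-Flags⁻ wy∈
          vw′ , _ , y′-fixes = ∈-Flags⁻ w′y′∈
          to-vw = maps-∘ (r w) y y-fixes (r-maps vw)
          to-vw′ = subst (λ σ → MapsPair σ u v v w′) (sym same) (maps-∘ (r w′) y′ y′-fixes (r-maps vw′))
          w≡w′ = same-far-end vw (sp-trans (sp-sym to-vw) to-vw′)
        in cong₂ _,_ w≡w′ (cancelˡ (choose-∈ _) (trans same (cong (λ z → r z ∘P y′) (sym w≡w′)))) }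
    }
    where
      meets-v : ∀ z {w} → MapsPair z u v v w → (app z u ≡ v) ⊎ (app z v ≡ v)
      meets-v _ (inj₁ (zu≡v , _)) = inj₁ zu≡v
      meets-v _ (inj₂ (_ , zv≡v)) = inj₂ zv≡v

  orbit-count : length (filter (λ x → app x u ≟ v) N) + length (stab N v) ≡ valency Γ v * length (stabE N u v)
  orbit-count = begin
    length (filter (λ x → app x u ≟ v) N) + length (stab N v) ≡⟨ sym AtV-split ⟩
    length AtV   ≡⟨ bijection-length (Unique.filter⁺ atV? unique)
                      (Unique.cartesianProduct⁺ (neighbours-unique v) (Unique.filter⁺ (λ x → maps? x u v u v) unique))
                      to-flag from-flag ⟩
    length Flags ≡⟨ length-cartesianProduct (neighbours v) (stabE N u v) ⟩
    valency Γ v * length (stabE N u v) ∎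
    where open ≡-Reasoning

stabiliser-bounds : ∀ {d e s} → 3 ≤ d → 1 ≤ e → d * e ≤ 2 * s → 2 ≤ s × s ≢ e
stabiliser-bounds {d} {e} {s} 3≤d 1≤e de≤2s =
  at-least-two s (ℕ.≤-trans (ℕ.*-monoʳ-≤ 3 1≤e) 3e≤2s) ,
  λ s≡e → ℕ.<-irrefl refl (ℕ.≤-trans (ℕ.+-monoˡ-≤ (2 * e) 1≤e) (subst (λ m → 3 * e ≤ 2 * m) s≡e 3e≤2s))
  where
    3e≤2s : 3 * e ≤ 2 * s
    3e≤2s = ℕ.≤-trans (ℕ.*-monoˡ-≤ e 3≤d) de≤2s
    at-least-two : ∀ m → 3 ≤ 2 * m → 2 ≤ m
    at-least-two (suc (suc _)) _ = s≤s (s≤s z≤n)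
    at-least-two zero ()
    at-least-two (suc zero) (s≤s (s≤s ()))

module Setting {n : ℕ} (Γ : Graph n) (d : ℕ) (G N : List (Perm n)) (u v : Fin n)
  (conn : Connected Γ) (reg : Regular Γ d) (d≥3 : d ≥ 3)
  (aut : AutGroup Γ G) (prim : EdgePrimitive Γ G)
  (uv : Adj Γ u v) (nor : Normal N G) (ntr : Nontrivial N) where

  NG : PermGroup n N
  NG = proj₁ nor

  open PermGroup NG using (unique; has-id)

  autN : AutGroup Γ N
  autN = NG , λ x∈ → proj₂ aut (proj₁ (proj₂ nor) x∈)

  branching : ∀ w → 2 ≤ valency Γ w
  branching w = subst (2 ≤_) (sym (reg w)) (ℕ.≤-trans (ℕ.n≤1+n 2) d≥3)

  open NormalEdgeTransitivity Γ aut prim nor ntr branching uv using (edge-transitive)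

  Shift : List (Perm n)
  Shift = filter (λ x → app x u ≟ v) N

  shift-count : length Shift + length (stab N v) ≡ d * length (stabE N u v)
  shift-count = trans (FlagCount.orbit-count Γ autN uv edge-transitive)
                      (cong (_* length (stabE N u v)) (reg v))

  shift⇒transitive : ∀ {t} → t ∈ N → app t u ≡ v → VertexTransitive N
  shift⇒transitive = VertexTransitivity.vertex-transitive Γ NG conn edge-transitive

  -- For vertex-transitive N, Shift is a coset of N_v.
  transitive-shift : VertexTransitive N → length Shift ≡ length (stab N v)
  transitive-shift vt = let _ , t∈ , tu≡v = vt u v in PermGroupFacts.coset-size NG t∈ tu≡v

  intransitive-shift : ¬ VertexTransitive N → length Shift ≡ 0
  intransitive-shift nvt = cong length (filter-none (λ x → app x u ≟ v)
    (All.tabulate λ x∈ xu≡v → nvt (shift⇒transitive x∈ xu≡v)))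

  -- For intransitive N no element swaps u and v, so N_{u,v} = N_uv.
  setwise≡pointwise : ¬ VertexTransitive N → length (stabE N u v) ≡ length (stab2 N u v)
  setwise≡pointwise nvt =
    length-filter-cong (λ x → maps? x u v u v) (λ x → (app x u ≟ u) ×-dec (app x v ≟ v)) N
      (λ { _ (inj₁ fixes) → fixes ; x∈ (inj₂ (xu≡v , _)) → ⊥-elim (nvt (shift⇒transitive x∈ xu≡v)) })
      (λ _ fixes → inj₁ fixes)

  -- Shift is a coset of N_v or empty, according as some x ∈ N maps u to v or not.
  shift≤stab : length Shift ≤ length (stab N v)
  shift≤stab with search (λ x → app x u ≟ v) N
  ... | yes (_ , t∈ , tu≡v) = ℕ.≤-reflexive (transitive-shift (shift⇒transitive t∈ tu≡v))
  ... | no none = subst (_≤ length (stab N v)) (sym (intransitive-shift (λ vt → none (vt u v)))) z≤n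

  -- In both cases d |N_{u,v}| ≤ 2 |N_v|, and the identity lies in N_{u,v}.
  bounds : 2 ≤ length (stab N v) × length (stab N v) ≢ length (stabE N u v)
  bounds = stabiliser-bounds d≥3 (∈-length (∈-filter⁺ (λ x → maps? x u v u v) has-id maps-id)) (begin
    d * length (stabE N u v)                 ≡⟨ sym shift-count ⟩
    length Shift + length (stab N v)         ≤⟨ ℕ.+-monoˡ-≤ (length (stab N v)) shift≤stab ⟩
    length (stab N v) + length (stab N v)    ≡⟨ cong (length (stab N v) +_) (sym (ℕ.+-identityʳ _)) ⟩
    2 * length (stab N v)                    ∎)
    where open ℕ.≤-Reasoning

  transitive-case : VertexTransitive N → 2 * length (stab N v) ≡ d * length (stabE N u v)
  transitive-case vt = begin
    2 * length (stab N v)                 ≡⟨ cong (length (stab N v) +_) (ℕ.+-identityʳ _) ⟩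
    length (stab N v) + length (stab N v) ≡⟨ cong (_+ length (stab N v)) (sym (transitive-shift vt)) ⟩
    length Shift + length (stab N v)      ≡⟨ shift-count ⟩
    d * length (stabE N u v)              ∎
    where open ≡-Reasoning

  intransitive-case : ¬ VertexTransitive N → length (stab N v) ≡ d * length (stabE N u v)
  intransitive-case nvt = trans (cong (_+ length (stab N v)) (sym (intransitive-shift nvt))) shift-count

  nontrivial-stab : Nontrivial (stab N v)
  nontrivial-stab = non-identity (stab N v) (Unique.filter⁺ (λ x → app x v ≟ v) unique) (proj₁ bounds)

  same-stabilisers : (∀ x → x ∈ N → (x ∈ stab N v → x ∈ stabE N u v) × (x ∈ stabE N u v → x ∈ stab N v)) →
    length (stab N v) ≡ length (stabE N u v)
  same-stabilisers same = length-filter-cong (λ x → app x v ≟ v) (λ x → maps? x u v u v) N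
    (λ x∈ xv≡v → proj₂ (∈-filter⁻ (λ x → maps? x u v u v) {xs = N}
                   (proj₁ (same _ x∈) (∈-filter⁺ (λ x → app x v ≟ v) x∈ xv≡v))))
    (λ x∈ fixes → proj₂ (∈-filter⁻ (λ x → app x v ≟ v) {xs = N}
                   (proj₂ (same _ x∈) (∈-filter⁺ (λ x → maps? x u v u v) x∈ fixes))))

lemma3p1 : ∀ {n} (Γ : Graph n) (d : ℕ) (G N : List (Perm n)) (u v : Fin n) →
    Connected Γ → Regular Γ d → d ≥ 3 →
    AutGroup Γ G → EdgePrimitive Γ G →
    Adj Γ u v → Normal N G → Nontrivial N →
    (VertexTransitive N → 2 * length (stab N v) ≡ d * length (stabE N u v)) ×
    (¬ VertexTransitive N →
      (length (stab N v) ≡ d * length (stabE N u v)) ×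
      (d * length (stabE N u v) ≡ d * length (stab2 N u v))) ×
    Nontrivial (stab N v) ×
    ¬ (∀ x → x ∈ N → (x ∈ stab N v → x ∈ stabE N u v) × (x ∈ stabE N u v → x ∈ stab N v))
lemma3p1 Γ d G N u v conn reg d≥3 aut prim uv nor ntr =
    transitive-case
  , (λ nvt → intransitive-case nvt , cong (d *_) (setwise≡pointwise nvt))
  , nontrivial-stab
  , λ same → proj₂ bounds (same-stabilisers same)
  where open Setting Γ d G N u v conn reg d≥3 aut prim uv nor ntr
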